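{- For all $N\ge 0$, all $\alpha,\beta\in\{B,W,\bot\}^N$ and all input edges $\sigma,\tau$ of the input graph, if $\mathsf{view}_B(\alpha,\sigma)=\mathsf{view}_B(\beta,\tau)$ and $\mathsf{view}_W(\alpha,\sigma)=\mathsf{view}_W(\beta,\tau)$, then $\alpha=\beta$ and $\sigma=\tau$.
   Context: Two processes $B$ and $W$. The input graph is a chromatic labeled graph whose vertices are pairs $(P,v)$ with $P\in\{B,W\}$ the color and $v$ an input value from a set $V^{in}$ (each vertex uniquely determined by its color and value), and whose edges have the form $\sigma=\{(B,i),(W,j)\}$. Views are formal terms: input values, or ordered pairs $(V,V')$ whose components are views or the special symbol $\Box$ (not an input value; pairs are distinct from input values). For an input edge $\sigma=\{(B,i),(W,j)\}$ and a word $\alpha$ over $\{B,W,\bot\}$, views are defined by induction on the length: $\mathsf{view}_B(\varepsilon,\sigma)=i$, $\mathsf{view}_W(\varepsilon,\sigma)=j$; for $\alpha x$ with $x\in\{B,W,\bot\}$, writing $V_B=\mathsf{view}_B(\alpha,\sigma)$ and $V_W=\mathsf{view}_W(\alpha,\sigma)$: if $x=B$ then $\mathsf{view}_B(\alpha x,\sigma)=(V_B,V_W)$ and $\mathsf{view}_W(\alpha x,\sigma)=(\Box,V_W)$; if $x=W$ then $\mathsf{view}_B(\alpha x,\sigma)=(V_B,\Box)$ and $\mathsf{view}_W(\alpha x,\sigma)=(V_B,V_W)$; if $x=\bot$ then both views are $(V_B,V_W)$. -}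

module Defs where

open import Data.Nat using (ℕ; suc)
open import Relation.Binary.PropositionalEquality using (_≡_)
open import Data.Vec using (Vec; []; foldl)
open import Data.Product using (Σ; _×_; _,_; proj₁; proj₂)

data Letter : Set where
  B W bot : Letter

-- Views over a set of input values: input values, the symbol □, and ordered pairs.
-- (□ is only meant to occur as a pair component; the constructor `box` models it.)
data View (Vin : Set) : Set where
  val  : Vin → View Vin
  box  : View Vin
  pair : View Vin → View Vin → View Vin

-- A chromatic input graph on input values V^in: vertices are (B,v) and (W,v);
-- edges {(B,i),(W,j)} are recorded by the relation Edge i j.
record InputGraph (Vin : Set) : Set₁ where
  field
    Edge : Vin → Vin → Set

InputEdge : {Vin : Set} → InputGraph Vin → Set
InputEdge {Vin} G = Σ Vin λ i → Σ Vin λ j → InputGraph.Edge G i j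

SameEdge : {Vin : Set} {G : InputGraph Vin} → InputEdge G → InputEdge G → Set
SameEdge (i , j , _) (i' , j' , _) = (i ≡ i') × (j ≡ j')

step : {Vin : Set} → View Vin × View Vin → Letter → View Vin × View Vin
step (vb , vw) B   = pair vb vw , pair box vw
step (vb , vw) W   = pair vb box , pair vb vw
step (vb , vw) bot = pair vb vw , pair vb vw

views : {Vin : Set} {N : ℕ} → Vec Letter N → Vin → Vin → View Vin × View Vin
views α i j = foldl (λ _ → View _ × View _) step (val i , val j) α

viewB : {Vin : Set} {G : InputGraph Vin} {N : ℕ} → Vec Letter N → InputEdge G → View Vin
viewB α (i , j , _) = proj₁ (views α i j)

viewW : {Vin : Set} {G : InputGraph Vin} {N : ℕ} → Vec Letter N → InputEdge G → View Vin
viewW α (i , j , _) = proj₂ (views α i j)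

-- A step never produces □ as a whole view, and on such states it is injective:
-- the letter is recovered from where □ occurs inside the new views, and the
-- old views are their components.  Folding, a run is determined by its final views.

module Submission where

open import Defs
open import Data.Nat using (ℕ)
open import Data.Vec using (Vec; []; _∷_; foldl)
open import Data.Product using (_×_; _,_)
open import Data.Empty using (⊥)
open import Data.Unit using (⊤; tt)
open import Relation.Binary.PropositionalEquality using (_≡_; refl; cong₂)

module _ {Vin : Set} where

  NotBox : View Vin → Set
  NotBox box = ⊥
  NotBox _   = ⊤

  BoxFree : View Vin × View Vin → Set
  BoxFree (vb , vw) = NotBox vb × NotBox vw

  step-boxFree : (p : View Vin × View Vin) (x : Letter) → BoxFree (step p x)
  step-boxFree _ B   = tt , tt
  step-boxFree _ W   = tt , tt
  step-boxFree _ bot = tt , tt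

  step-injective : (p q : View Vin × View Vin) (x y : Letter) → BoxFree p → BoxFree q →
                   step p x ≡ step q y → (x ≡ y) × (p ≡ q)
  step-injective _          _          B   B   _        _        refl = refl , refl
  step-injective _          _          W   W   _        _        refl = refl , refl
  step-injective _          _          bot bot _        _        refl = refl , refl
  step-injective (_ , box)  _          B   W   (_ , ()) _        refl
  step-injective _          (box , _)  B   bot _        (() , _) refl
  step-injective _          (box , _)  W   B   _        (() , _) refl
  step-injective (_ , box)  _          W   bot (_ , ()) _        refl
  step-injective (box , _)  _          bot B   (() , _) _        refl
  step-injective _          (_ , box)  bot W   _        (_ , ()) refl

  run : {n : ℕ} → View Vin × View Vin → Vec Letter n → View Vin × View Vin
  run = foldl (λ _ → View Vin × View Vin) step

  run-injective : {n : ℕ} (p q : View Vin × View Vin) → BoxFree p → BoxFree q →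
                  (α β : Vec Letter n) → run p α ≡ run q β → (α ≡ β) × (p ≡ q)
  run-injective p q _  _  []      []      same = refl , same
  run-injective p q bp bq (x ∷ α) (y ∷ β) same
    with run-injective (step p x) (step q y) (step-boxFree p x) (step-boxFree q y) α β same
  ... | refl , sameStep with step-injective p q x y bp bq sameStep
  ... | refl , p≡q = refl , p≡q

lemma7 : {Vin : Set} (G : InputGraph Vin) (N : ℕ) (α β : Vec Letter N) (σ τ : InputEdge G) →
           viewB α σ ≡ viewB β τ → viewW α σ ≡ viewW β τ →
           (α ≡ β) × SameEdge σ τ
lemma7 G N α β (i , j , _) (i' , j' , _) sameB sameW
  with run-injective (val i , val j) (val i' , val j') (tt , tt) (tt , tt) α β
                     (cong₂ _,_ sameB sameW)
... | α≡β , refl = α≡β , refl , refl
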